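{- Let $p=(123,\emptyset,\emptyset)$ (the classical pattern $123$) and $r=(132,\emptyset,\{2\})$. Then for every $n\ge 0$, $|\mathrm{Av}_n(p,r)|=M_n$, the $n$th Motzkin number.
   Context: For $n\ge 0$, $\mathcal{S}_n$ is the set of permutations of $[n]=\{1,\dots,n\}$, written as words $\pi=\pi(1)\pi(2)\cdots\pi(n)$. Two words of distinct integers of the same length are order-isomorphic if their entries appear in the same relative order. A pattern of length 3 is a triple $(\sigma,X,Y)$ with $\sigma\in\mathcal{S}_3$ and $X,Y\subseteq\{1,2\}$. A permutation $\pi\in\mathcal{S}_n$ contains $(\sigma,X,Y)$ if there are indices $i_1<i_2<i_3$ such that $\pi(i_1)\pi(i_2)\pi(i_3)$ is order-isomorphic to $\sigma$, $i_{x+1}=i_x+1$ for every $x\in X$, and $j_{y+1}=j_y+1$ for every $y\in Y$, where $j_1<j_2<j_3$ are the three values $\pi(i_1),\pi(i_2),\pi(i_3)$ listed in increasing order; otherwise $\pi$ avoids it. For patterns $P_1,\dots,P_m$, $\mathrm{Av}_n(P_1,\dots,P_m)$ is the set of $\pi\in\mathcal{S}_n$ avoiding every $P_i$. The Motzkin numbers $M_n$ are defined by the formal power series identity $M=1+xM+x^2M^2$ where $M=\sum_{n\ge0}M_nx^n$ (so $M_0,M_1,\dots=1,1,2,4,9,21,\dots$). -}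

module Defs where

open import Data.Nat using (ℕ; zero; suc; _+_; _*_; _<_)
open import Data.Fin using (Fin; toℕ; zero; suc)
open import Data.Fin.Subset using (Subset; _∈_; ⊥; ⁅_⁆)
open import Data.Vec using (Vec; []; _∷_; lookup; reverse; zipWith; sum; head)
open import Data.Product using (Σ; _×_; ∃)
open import Function.Bundles using (_⇔_)
open import Function.Definitions using (Injective)
open import Relation.Binary.PropositionalEquality using (_≡_)
open import Relation.Nullary using (¬_)

-- A permutation of [n] written as a word π(1)…π(n); values in Fin n stand for 1..n.
Word : ℕ → Set
Word n = Vec (Fin n) n

IsPerm : ∀ {n} → Word n → Set
IsPerm {n} π = Injective _≡_ _≡_ (lookup π)

-- A pattern of length 3 (σ, X, Y): σ ∈ S₃ as a word of length 3 (positions/values 0,1,2),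
-- X, Y ⊆ {1,2} encoded as subsets of Fin 2 (element x stands for x+1).
record Pattern : Set where
  constructor pat
  field
    σ : Vec (Fin 3) 3
    X : Subset 2
    Y : Subset 2

inj : Fin 2 → Fin 3
inj zero = zero
inj (suc zero) = suc zero

nxt : Fin 2 → Fin 3
nxt zero = suc zero
nxt (suc zero) = suc (suc zero)

Contains : ∀ {n} → Word n → Pattern → Set
Contains {n} π (pat σ X Y) =
  Σ (Fin 3 → Fin n) λ ι →
    (∀ (k l : Fin 3) → toℕ k < toℕ l → toℕ (ι k) < toℕ (ι l))
  × (∀ (k l : Fin 3) → (toℕ (lookup σ k) < toℕ (lookup σ l) ⇔ toℕ (lookup π (ι k)) < toℕ (lookup π (ι l))))
  × (∀ (x : Fin 2) → x ∈ X → toℕ (ι (nxt x)) ≡ suc (toℕ (ι (inj x))))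
  -- the value of rank y+1 (position l with σ l = y+1) is one more than the value of rank y (position k with σ k = y)
  × (∀ (y : Fin 2) (k l : Fin 3) → y ∈ Y → lookup σ k ≡ inj y → lookup σ l ≡ nxt y →
       toℕ (lookup π (ι l)) ≡ suc (toℕ (lookup π (ι k))))

Avoids : ∀ {n} → Word n → Pattern → Set
Avoids π P = ¬ Contains π P

InAv₂ : ∀ {n} → Pattern → Pattern → Word n → Set
InAv₂ p r π = IsPerm π × Avoids π p × Avoids π r

p123 : Pattern
p123 = pat (zero ∷ suc zero ∷ suc (suc zero) ∷ []) ⊥ ⊥

-- r = (132, ∅, {2})   (element 2 of {1,2} is suc zero in Fin 2)
r132 : Pattern
r132 = pat (zero ∷ suc (suc zero) ∷ suc zero ∷ []) ⊥ ⁅ suc zero ⁆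

-- Motzkin numbers via the recurrence equivalent to M = 1 + xM + x²M²:
-- M₀ = 1, M_{n+1} = M_n + Σ_{k=0}^{n-1} M_k M_{n-1-k}.
-- motzRev n = [M_n, M_{n-1}, …, M_0]
motzRev : (n : ℕ) → Vec ℕ (suc n)
motzRev zero = 1 ∷ []
motzRev (suc n) with motzRev n
... | m ∷ ms = (m + sum (zipWith _*_ ms (reverse ms))) ∷ m ∷ ms

motzkin : ℕ → ℕ
motzkin n = head (motzRev n)

-- "the set {π ∈ Word n | P π} has exactly m elements": an injective enumeration
-- Fin m → Word n whose image is exactly the words satisfying P.
HasCard : ∀ {n} → (Word n → Set) → ℕ → Set
HasCard {n} P m =
  Σ (Fin m → Word n) λ f →
    Injective _≡_ _≡_ f × (∀ k → P (f k)) × (∀ π → P π → ∃ λ k → f k ≡ π)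

-- Appending a last entry of value v (the earlier
-- entries ≥ v move up by one) keeps it inside Av(123, r) exactly when v ≤ e, where e + 1 is
-- the least value of an entry that is not a left-to-right minimum (e = n if there is none).
-- Appending 0 turns e into e + 1, and appending v ∈ [1, e] turns it into v − 1.  Hence
-- Av_n(p, r) is in bijection with the paths of length n starting at height 0 whose steps go
-- up by one or down to any lower height.  Cutting such a path after its first step and at its
-- first return to height 0 gives P_{n+1} = P_n + Σ_{k+l=n-1} P_k P_l, the Motzkin recurrence.

module Submission where

open import Defs
open import Data.Nat using (ℕ; zero; suc; _+_; _*_; _∸_; _<_; _≤_; z≤n; s≤s; s≤s⁻¹; z<s; s<s; _<?_; _≟_)
open import Data.Nat.Properties
open import Data.Nat.Induction using (<-rec)
open import Data.Fin using (Fin; zero; suc; toℕ; fromℕ; fromℕ<; inject₁; inject≤; punchIn; punchOut)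
open import Data.Fin.Patterns using (0F; 1F; 2F)
open import Data.Fin.Properties
  using (+↔⊎; *↔×; toℕ-fromℕ; toℕ-inject₁; toℕ<n; toℕ-injective; inject₁-injective; fromℕ≢inject₁;
         punchIn-injective; punchInᵢ≢i; punchIn-mono-≤; punchIn-punchOut; punchOut-injective; any?; <⇒notInjective;
         toℕ-inject≤; inject≤-injective; toℕ-fromℕ<)
  renaming (_≟_ to _≟ᶠ_; suc-injective to Fin-suc-injective)
open import Data.Fin.Subset using (_∈_)
open import Data.Fin.Subset.Properties using (∉⊥; x∈⁅x⁆; x∈⁅y⁆⇒x≡y)
open import Data.Vec using (Vec; []; _∷_; _∷ʳ_; lookup; map; tabulate; sum; zipWith; reverse; tail)
open import Data.Vec.Properties
  using (reverse-∷; ∷-injective; ∷ʳ-injective; lookup-map; lookup∘tabulate; tabulate∘lookup; tabulate-cong)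
open import Data.Product using (Σ; Σ-syntax; ∃; _×_; _,_; proj₁; proj₂)
open import Data.Product.Function.Dependent.Propositional using (Σ-↔)
open import Data.Sum using (_⊎_; inj₁; inj₂)
open import Data.Sum.Function.Propositional using (_⊎-↔_)
open import Data.Empty using (⊥-elim)
open import Function.Base using (_∘_)
open import Function.Bundles using (_↔_; mk↔ₛ′; Inverse; _⇔_; mk⇔; Equivalence)
open import Function.Definitions using (Injective)
open import Function.Properties.Inverse using (↔-refl; ↔-sym)
open import Function.Related.Propositional using (bijection; module EquationalReasoning)
open import Relation.Nullary using (¬_; yes; no)
open import Relation.Binary.Definitions using (tri<; tri≈; tri>)
open import Relation.Binary.PropositionalEquality

-- Σ over k + l = n − 1 of A k × B l, with the sum written l + k because path lengths add up
-- that way in return-then.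
Conv : (ℕ → Set) → (ℕ → Set) → ℕ → Set
Conv A B n = Σ[ k ∈ ℕ ] Σ[ l ∈ ℕ ] (suc (l + k) ≡ n) × A k × B l

Conv-suc : ∀ {A B : ℕ → Set} m → Conv A B (suc m) ↔ ((A m × B 0) ⊎ Conv A (λ l → B (suc l)) m)
Conv-suc {A} {B} m = mk↔ₛ′ to from to-from from-to
  where
  to : Conv A B (suc m) → (A m × B 0) ⊎ Conv A (λ l → B (suc l)) m
  to (k , zero , refl , a , b) = inj₁ (a , b)
  to (k , suc l , refl , a , b) = inj₂ (k , l , refl , a , b)
  from : (A m × B 0) ⊎ Conv A (λ l → B (suc l)) m → Conv A B (suc m)
  from (inj₁ (a , b)) = m , zero , refl , a , b
  from (inj₂ (k , l , refl , a , b)) = k , suc l , refl , a , b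
  to-from : ∀ x → to (from x) ≡ x
  to-from (inj₁ _) = refl
  to-from (inj₂ (k , l , refl , a , b)) = refl
  from-to : ∀ x → from (to x) ≡ x
  from-to (k , zero , refl , a , b) = refl
  from-to (k , suc l , refl , a , b) = refl

Conv-cong : ∀ {A A′ B B′ : ℕ → Set} {n} →
            (∀ {k} → k < n → A k ↔ A′ k) → (∀ {l} → l < n → B l ↔ B′ l) →
            Conv A B n ↔ Conv A′ B′ n
Conv-cong {A} {A′} {B} {B′} {n} f g = mk↔ₛ′ to from to-from from-to
  where
  k<n : ∀ {k l} → suc (l + k) ≡ n → k < n
  k<n {k} {l} refl = s≤s (m≤n+m k l)
  l<n : ∀ {k l} → suc (l + k) ≡ n → l < n
  l<n {k} {l} refl = s≤s (m≤m+n l k)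
  to : Conv A B n → Conv A′ B′ n
  to (k , l , eq , a , b) = k , l , eq , Inverse.to (f (k<n eq)) a , Inverse.to (g (l<n eq)) b
  from : Conv A′ B′ n → Conv A B n
  from (k , l , eq , a , b) = k , l , eq , Inverse.from (f (k<n eq)) a , Inverse.from (g (l<n eq)) b
  to-from : ∀ x → to (from x) ≡ x
  to-from (k , l , eq , a , b) =
    cong₂ (λ a b → k , l , eq , a , b) (Inverse.strictlyInverseˡ (f _) a) (Inverse.strictlyInverseˡ (g _) b)
  from-to : ∀ x → from (to x) ≡ x
  from-to (k , l , eq , a , b) =
    cong₂ (λ a b → k , l , eq , a , b) (Inverse.strictlyInverseʳ (f _) a) (Inverse.strictlyInverseʳ (g _) b)

Σ-Fin-suc : ∀ {n} (P : Fin (suc n) → Set) → Σ (Fin (suc n)) P ↔ (P zero ⊎ Σ (Fin n) (λ i → P (suc i)))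
Σ-Fin-suc {n} P = mk↔ₛ′ to from to-from from-to
  where
  to : Σ (Fin (suc n)) P → P zero ⊎ Σ (Fin n) (λ i → P (suc i))
  to (zero , p) = inj₁ p
  to (suc i , p) = inj₂ (i , p)
  from : P zero ⊎ Σ (Fin n) (λ i → P (suc i)) → Σ (Fin (suc n)) P
  from (inj₁ p) = zero , p
  from (inj₂ (i , p)) = suc i , p
  to-from : ∀ x → to (from x) ≡ x
  to-from (inj₁ _) = refl
  to-from (inj₂ _) = refl
  from-to : ∀ x → from (to x) ≡ x
  from-to (zero , _) = refl
  from-to (suc _ , _) = refl

Fin-sum-zipWith-* : ∀ {n} (a b : Fin n → ℕ) →
                    Fin (sum (zipWith _*_ (tabulate a) (tabulate b))) ↔ (Σ[ i ∈ Fin n ] Fin (a i) × Fin (b i))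
Fin-sum-zipWith-* {zero} a b = mk↔ₛ′ (λ ()) (λ ()) (λ ()) (λ ())
Fin-sum-zipWith-* {suc n} a b = begin
  Fin (a zero * b zero + sum (zipWith _*_ (tabulate (a ∘ suc)) (tabulate (b ∘ suc))))
    ↔⟨ +↔⊎ ⟩
  (Fin (a zero * b zero) ⊎ Fin (sum (zipWith _*_ (tabulate (a ∘ suc)) (tabulate (b ∘ suc)))))
    ↔⟨ *↔× ⊎-↔ Fin-sum-zipWith-* (a ∘ suc) (b ∘ suc) ⟩
  ((Fin (a zero) × Fin (b zero)) ⊎ (Σ[ i ∈ Fin n ] Fin (a (suc i)) × Fin (b (suc i))))
    ↔⟨ ↔-sym (Σ-Fin-suc _) ⟩
  (Σ[ i ∈ Fin (suc n) ] Fin (a i) × Fin (b i)) ∎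
  where open EquationalReasoning {k = bijection}

Σ-Fin-↔-Conv : ∀ {A B : ℕ → Set} n →
               (Σ[ i ∈ Fin n ] A (n ∸ suc (toℕ i)) × B (toℕ i)) ↔ Conv A B n
Σ-Fin-↔-Conv {A} {B} zero = mk↔ₛ′ (λ ()) (λ ()) (λ ()) (λ ())
Σ-Fin-↔-Conv {A} {B} (suc m) = begin
  (Σ[ i ∈ Fin (suc m) ] A (m ∸ toℕ i) × B (toℕ i))
    ↔⟨ Σ-Fin-suc _ ⟩
  ((A m × B 0) ⊎ (Σ[ i ∈ Fin m ] A (m ∸ suc (toℕ i)) × B (suc (toℕ i))))
    ↔⟨ ↔-refl ⊎-↔ Σ-Fin-↔-Conv m ⟩
  ((A m × B 0) ⊎ Conv A (λ l → B (suc l)) m)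
    ↔⟨ ↔-sym (Conv-suc m) ⟩
  Conv A B (suc m) ∎
  where open EquationalReasoning {k = bijection}

-- The Motzkin recurrence

ascending descending : ∀ {A : Set} → (ℕ → A) → (n : ℕ) → Vec A n
ascending g n = tabulate (λ i → g (toℕ i))
descending g n = tabulate (λ i → g (n ∸ suc (toℕ i)))

ascending-∷ʳ : ∀ {A : Set} (g : ℕ → A) n → ascending g n ∷ʳ g n ≡ ascending g (suc n)
ascending-∷ʳ g zero = refl
ascending-∷ʳ g (suc n) = cong (g 0 ∷_) (ascending-∷ʳ (λ k → g (suc k)) n)

reverse-descending : ∀ {A : Set} (g : ℕ → A) n → reverse (descending g n) ≡ ascending g n
reverse-descending g zero = refl
reverse-descending g (suc n) = begin
  reverse (g n ∷ descending g n)    ≡⟨ reverse-∷ (g n) (descending g n) ⟩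
  reverse (descending g n) ∷ʳ g n   ≡⟨ cong (_∷ʳ g n) (reverse-descending g n) ⟩
  ascending g n ∷ʳ g n              ≡⟨ ascending-∷ʳ g n ⟩
  ascending g (suc n)               ∎
  where open ≡-Reasoning

motzkin-suc : ∀ n → motzkin (suc n) ≡ motzkin n + sum (zipWith _*_ (tail (motzRev n)) (reverse (tail (motzRev n))))
motzkin-suc n with motzRev n
... | _ ∷ _ = refl

motzRev-suc : ∀ n → motzRev (suc n) ≡ motzkin (suc n) ∷ motzRev n
motzRev-suc n with motzRev n
... | _ ∷ _ = refl

motzRev-descending : ∀ n → motzRev n ≡ descending motzkin (suc n)
motzRev-descending zero = refl
motzRev-descending (suc n) = trans (motzRev-suc n) (cong (motzkin (suc n) ∷_) (motzRev-descending n))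

motzkin-convolution : ∀ n → motzkin (suc n) ≡ motzkin n + sum (zipWith _*_ (descending motzkin n) (ascending motzkin n))
motzkin-convolution n = begin
  motzkin (suc n)
    ≡⟨ motzkin-suc n ⟩
  motzkin n + sum (zipWith _*_ (tail (motzRev n)) (reverse (tail (motzRev n))))
    ≡⟨ cong (λ v → motzkin n + sum (zipWith _*_ v (reverse v))) (cong tail (motzRev-descending n)) ⟩
  motzkin n + sum (zipWith _*_ (descending motzkin n) (reverse (descending motzkin n)))
    ≡⟨ cong (λ v → motzkin n + sum (zipWith _*_ (descending motzkin n) v)) (reverse-descending motzkin n) ⟩
  motzkin n + sum (zipWith _*_ (descending motzkin n) (ascending motzkin n))
    ∎
  where open ≡-Reasoning

FinM : ℕ → Set
FinM n = Fin (motzkin n)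

FinM-suc : ∀ n → FinM (suc n) ↔ (FinM n ⊎ Conv FinM FinM n)
FinM-suc n = begin
  FinM (suc n)
    ≡⟨ cong Fin (motzkin-convolution n) ⟩
  Fin (motzkin n + sum (zipWith _*_ (descending motzkin n) (ascending motzkin n)))
    ↔⟨ +↔⊎ ⟩
  (FinM n ⊎ Fin (sum (zipWith _*_ (descending motzkin n) (ascending motzkin n))))
    ↔⟨ ↔-refl ⊎-↔ Fin-sum-zipWith-* _ _ ⟩
  (FinM n ⊎ (Σ[ i ∈ Fin n ] FinM (n ∸ suc (toℕ i)) × FinM (toℕ i)))
    ↔⟨ ↔-refl ⊎-↔ Σ-Fin-↔-Conv n ⟩
  (FinM n ⊎ Conv FinM FinM n)
    ∎
  where open EquationalReasoning {k = bijection}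

-- Paths

-- The last step is the outermost constructor, so that decoding appends entries at the end
-- of a word.
data Path (a : ℕ) : ℕ → ℕ → Set where
  ε   : Path a 0 a
  _↑  : ∀ {n e} → Path a n e → Path a (suc n) (suc e)
  _↓_ : ∀ {n e} → Path a n e → (j : Fin e) → Path a (suc n) (toℕ j)

Paths : ℕ → Set
Paths n = Σ ℕ (Path 0 n)

lift : ∀ {a n e} → Path a n e → Path (suc a) n (suc e)
lift ε       = ε
lift (p ↑)   = lift p ↑
lift (p ↓ j) = lift p ↓ suc j

↑∷_ : ∀ {a n e} → Path (suc a) n e → Path a (suc n) e
↑∷ ε       = ε ↑
↑∷ (p ↑)   = (↑∷ p) ↑
↑∷ (p ↓ j) = (↑∷ p) ↓ j

drop↑ : ∀ {n e} → Path 0 (suc n) e → Path 1 n e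
drop↑ {zero}  (ε ↑)   = ε
drop↑ {zero}  (ε ↓ ())
drop↑ {suc n} (p ↑)   = drop↑ p ↑
drop↑ {suc n} (p ↓ j) = drop↑ p ↓ j

↑∷-↔ : ∀ {n e} → Path 1 n e ↔ Path 0 (suc n) e
↑∷-↔ = mk↔ₛ′ ↑∷_ drop↑ ↑∷-drop↑ drop↑-↑∷
  where
  ↑∷-drop↑ : ∀ {n e} (p : Path 0 (suc n) e) → ↑∷ drop↑ p ≡ p
  ↑∷-drop↑ {zero}  (ε ↑)   = refl
  ↑∷-drop↑ {zero}  (ε ↓ ())
  ↑∷-drop↑ {suc n} (p ↑)   = cong _↑ (↑∷-drop↑ p)
  ↑∷-drop↑ {suc n} (p ↓ j) = cong (_↓ j) (↑∷-drop↑ p)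
  drop↑-↑∷ : ∀ {n e} (p : Path 1 n e) → drop↑ (↑∷ p) ≡ p
  drop↑-↑∷ ε       = refl
  drop↑-↑∷ (p ↑)   = cong _↑ (drop↑-↑∷ p)
  drop↑-↑∷ (p ↓ j) = cong (_↓ j) (drop↑-↑∷ p)

-- A path from height s + 1 either never visits 0, and is then a lifted path from s, or first
-- reaches 0 after k + 1 steps and continues as a path from 0.
data FirstReturn (s : ℕ) : ℕ → ℕ → Set where
  never   : ∀ {m e} → Path s m e → FirstReturn s m (suc e)
  returns : ∀ {k h l e} → Path s k h → Path 0 l e → FirstReturn s (suc (l + k)) e

return-then : ∀ {s k h l e} → Path s k h → Path 0 l e → Path (suc s) (suc (l + k)) e
return-then q ε       = lift q ↓ zero
return-then q (r ↑)   = return-then q r ↑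
return-then q (r ↓ j) = return-then q r ↓ j

unsplit : ∀ {s m e} → FirstReturn s m e → Path (suc s) m e
unsplit (never q)     = lift q
unsplit (returns q r) = return-then q r

split-↑ : ∀ {s m e} → FirstReturn s m e → FirstReturn s (suc m) (suc e)
split-↑ (never q)     = never (q ↑)
split-↑ (returns q r) = returns q (r ↑)

split-↓ : ∀ {s m e} → FirstReturn s m e → (j : Fin e) → FirstReturn s (suc m) (toℕ j)
split-↓ (never q)     zero    = returns q ε
split-↓ (never q)     (suc j) = never (q ↓ j)
split-↓ (returns q r) j       = returns q (r ↓ j)

split : ∀ {s m e} → Path (suc s) m e → FirstReturn s m e
split ε       = never ε
split (p ↑)   = split-↑ (split p)
split (p ↓ j) = split-↓ (split p) j

split-lift : ∀ {s m e} (q : Path s m e) → split (lift q) ≡ never q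
split-lift ε       = refl
split-lift (q ↑)   = cong split-↑ (split-lift q)
split-lift (q ↓ j) = cong (λ x → split-↓ x (suc j)) (split-lift q)

split-return-then : ∀ {s k h l e} (q : Path s k h) (r : Path 0 l e) → split (return-then q r) ≡ returns q r
split-return-then q ε       = cong (λ x → split-↓ x zero) (split-lift q)
split-return-then q (r ↑)   = cong split-↑ (split-return-then q r)
split-return-then q (r ↓ j) = cong (λ x → split-↓ x j) (split-return-then q r)

split-↔ : ∀ {s m e} → Path (suc s) m e ↔ FirstReturn s m e
split-↔ = mk↔ₛ′ split unsplit split-unsplit unsplit-split
  where
  split-unsplit : ∀ {s m e} (x : FirstReturn s m e) → split (unsplit x) ≡ x
  split-unsplit (never q)     = split-lift q
  split-unsplit (returns q r) = split-return-then q r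
  unsplit-split-↑ : ∀ {s m e} (x : FirstReturn s m e) → unsplit (split-↑ x) ≡ unsplit x ↑
  unsplit-split-↑ (never q)     = refl
  unsplit-split-↑ (returns q r) = refl
  unsplit-split-↓ : ∀ {s m e} (x : FirstReturn s m e) (j : Fin e) → unsplit (split-↓ x j) ≡ unsplit x ↓ j
  unsplit-split-↓ (never q)     zero    = refl
  unsplit-split-↓ (never q)     (suc j) = refl
  unsplit-split-↓ (returns q r) j       = refl
  unsplit-split : ∀ {s m e} (p : Path (suc s) m e) → unsplit (split p) ≡ p
  unsplit-split ε       = refl
  unsplit-split (p ↑)   = trans (unsplit-split-↑ (split p)) (cong _↑ (unsplit-split p))
  unsplit-split (p ↓ j) = trans (unsplit-split-↓ (split p) j) (cong (_↓ j) (unsplit-split p))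

Σ-FirstReturn-↔ : ∀ m → Σ ℕ (FirstReturn 0 m) ↔ (Paths m ⊎ Conv Paths Paths m)
Σ-FirstReturn-↔ m = mk↔ₛ′ to from to-from from-to
  where
  to : Σ ℕ (FirstReturn 0 m) → Paths m ⊎ Conv Paths Paths m
  to (_ , never {e = e} q) = inj₁ (e , q)
  to (e , returns {k} {h} {l} q r) = inj₂ (k , l , refl , (h , q) , (e , r))
  from : Paths m ⊎ Conv Paths Paths m → Σ ℕ (FirstReturn 0 m)
  from (inj₁ (e , q)) = suc e , never q
  from (inj₂ (k , l , refl , (h , q) , (e , r))) = e , returns q r
  to-from : ∀ x → to (from x) ≡ x
  to-from (inj₁ _) = refl
  to-from (inj₂ (k , l , refl , (h , q) , (e , r))) = refl
  from-to : ∀ x → from (to x) ≡ x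
  from-to (_ , never q) = refl
  from-to (_ , returns q r) = refl

Paths-suc : ∀ m → Paths (suc m) ↔ (Paths m ⊎ Conv Paths Paths m)
Paths-suc m = begin
  Paths (suc m)                ↔⟨ Σ-↔ ↔-refl (↔-sym ↑∷-↔) ⟩
  Σ ℕ (Path 1 m)               ↔⟨ Σ-↔ ↔-refl split-↔ ⟩
  Σ ℕ (FirstReturn 0 m)        ↔⟨ Σ-FirstReturn-↔ m ⟩
  (Paths m ⊎ Conv Paths Paths m) ∎
  where open EquationalReasoning {k = bijection}

motzkin↔Paths : ∀ n → FinM n ↔ Paths n
motzkin↔Paths = <-rec (λ n → FinM n ↔ Paths n) step
  where
  open EquationalReasoning {k = bijection}
  step : ∀ n → (∀ {k} → k < n → FinM k ↔ Paths k) → FinM n ↔ Paths n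
  step zero _ = mk↔ₛ′ (λ _ → 0 , ε) (λ _ → zero) (λ { (_ , ε) → refl }) (λ { zero → refl })
  step (suc m) rec = begin
    FinM (suc m)                   ↔⟨ FinM-suc m ⟩
    (FinM m ⊎ Conv FinM FinM m)    ↔⟨ rec (n<1+n m) ⊎-↔ Conv-cong (rec ∘ m<n⇒m<1+n) (rec ∘ m<n⇒m<1+n) ⟩
    (Paths m ⊎ Conv Paths Paths m) ↔⟨ ↔-sym (Paths-suc m) ⟩
    Paths (suc m)                  ∎

entry : ∀ {n} → Word n → Fin n → ℕ
entry π i = toℕ (lookup π i)

Has123 : ∀ {n} → Word n → Set
Has123 {n} π = Σ[ i ∈ Fin n ] Σ[ j ∈ Fin n ] Σ[ k ∈ Fin n ]
  toℕ i < toℕ j × toℕ j < toℕ k × entry π i < entry π j × entry π j < entry π k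

HasAdjacent132 : ∀ {n} → Word n → Set
HasAdjacent132 {n} π = Σ[ i ∈ Fin n ] Σ[ j ∈ Fin n ] Σ[ k ∈ Fin n ]
  toℕ i < toℕ j × toℕ j < toℕ k × entry π i < entry π k × entry π j ≡ suc (entry π k)

NonLRMin : ∀ {n} → Word n → ℕ → Set
NonLRMin {n} π w = Σ[ i ∈ Fin n ] Σ[ j ∈ Fin n ] toℕ i < toℕ j × entry π i < entry π j × entry π j ≡ w

Avoids₂ : ∀ {n} → Word n → Set
Avoids₂ π = ¬ Has123 π × ¬ HasAdjacent132 π

agree : ∀ {A B : Set} → A → B → A ⇔ B
agree a b = mk⇔ (λ _ → b) (λ _ → a)

disagree : ∀ {A B : Set} → ¬ A → ¬ B → A ⇔ B
disagree ¬a ¬b = mk⇔ (⊥-elim ∘ ¬a) (⊥-elim ∘ ¬b)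

triple : ∀ {n} → Fin n → Fin n → Fin n → Fin 3 → Fin n
triple i j k 0F = i
triple i j k 1F = j
triple i j k 2F = k

triple-increasing : ∀ {n} {i j k : Fin n} → toℕ i < toℕ j → toℕ j < toℕ k →
                    ∀ x y → toℕ x < toℕ y → toℕ (triple i j k x) < toℕ (triple i j k y)
triple-increasing i<j j<k 0F 1F _ = i<j
triple-increasing i<j j<k 0F 2F _ = <-trans i<j j<k
triple-increasing i<j j<k 1F 2F _ = j<k
triple-increasing _   _   0F 0F ()
triple-increasing _   _   1F 0F ()
triple-increasing _   _   1F 1F (s<s ())
triple-increasing _   _   2F 0F ()
triple-increasing _   _   2F 1F (s<s ())
triple-increasing _   _   2F 2F (s<s (s<s ()))

contains-p123 : ∀ {n} (π : Word n) → Contains π p123 ⇔ Has123 π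
contains-p123 π = mk⇔ to from
  where
  to : Contains π p123 → Has123 π
  to (ι , increasing , order , _ , _) =
    ι 0F , ι 1F , ι 2F , increasing 0F 1F z<s , increasing 1F 2F (s<s z<s) ,
    Equivalence.to (order 0F 1F) z<s , Equivalence.to (order 1F 2F) (s<s z<s)
  from : Has123 π → Contains π p123
  from (i , j , k , i<j , j<k , a , b) =
    triple i j k , triple-increasing i<j j<k , order , (λ _ ∈⊥ → ⊥-elim (∉⊥ ∈⊥)) , (λ _ _ _ ∈⊥ → ⊥-elim (∉⊥ ∈⊥))
    where
    order : ∀ x y → toℕ (lookup (Pattern.σ p123) x) < toℕ (lookup (Pattern.σ p123) y) ⇔
                    entry π (triple i j k x) < entry π (triple i j k y)
    order 0F 0F = disagree (λ ()) (<-irrefl refl)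
    order 0F 1F = agree z<s a
    order 0F 2F = agree z<s (<-trans a b)
    order 1F 0F = disagree (λ ()) (<-asym a)
    order 1F 1F = disagree (λ { (s<s ()) }) (<-irrefl refl)
    order 1F 2F = agree (s<s z<s) b
    order 2F 0F = disagree (λ ()) (<-asym (<-trans a b))
    order 2F 1F = disagree (λ { (s<s ()) }) (<-asym b)
    order 2F 2F = disagree (λ { (s<s (s<s ())) }) (<-irrefl refl)

contains-r132 : ∀ {n} (π : Word n) → Contains π r132 ⇔ HasAdjacent132 π
contains-r132 π = mk⇔ to from
  where
  to : Contains π r132 → HasAdjacent132 π
  to (ι , increasing , order , _ , adjacent) =
    ι 0F , ι 1F , ι 2F , increasing 0F 1F z<s , increasing 1F 2F (s<s z<s) ,
    Equivalence.to (order 0F 2F) z<s , adjacent 1F 2F 1F (x∈⁅x⁆ 1F) refl refl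
  from : HasAdjacent132 π → Contains π r132
  from (i , j , k , i<j , j<k , a , j≡k+1) =
    triple i j k , triple-increasing i<j j<k , order , (λ _ ∈⊥ → ⊥-elim (∉⊥ ∈⊥)) , adjacent
    where
    k<j : entry π k < entry π j
    k<j = subst (entry π k <_) (sym j≡k+1) (s<s ≤-refl)
    order : ∀ x y → toℕ (lookup (Pattern.σ r132) x) < toℕ (lookup (Pattern.σ r132) y) ⇔
                    entry π (triple i j k x) < entry π (triple i j k y)
    order 0F 0F = disagree (λ ()) (<-irrefl refl)
    order 0F 1F = agree z<s (<-trans a k<j)
    order 0F 2F = agree z<s a
    order 1F 0F = disagree (λ ()) (<-asym (<-trans a k<j))
    order 1F 1F = disagree (λ { (s<s (s<s ())) }) (<-irrefl refl)
    order 1F 2F = disagree (λ { (s<s ()) }) (<-asym k<j)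
    order 2F 0F = disagree (λ ()) (<-asym a)
    order 2F 1F = agree (s<s z<s) k<j
    order 2F 2F = disagree (λ { (s<s ()) }) (<-irrefl refl)
    adjacent : ∀ y x z → y ∈ Pattern.Y r132 →
               lookup (Pattern.σ r132) x ≡ inj y → lookup (Pattern.σ r132) z ≡ nxt y →
               entry π (triple i j k z) ≡ suc (entry π (triple i j k x))
    adjacent y x z y∈ with x∈⁅y⁆⇒x≡y 1F y∈
    adjacent _ 2F 1F _ | refl = λ _ _ → j≡k+1
    adjacent _ 0F _  _ | refl = λ ()
    adjacent _ 1F _  _ | refl = λ ()
    adjacent _ 2F 0F _ | refl = λ _ ()
    adjacent _ 2F 2F _ | refl = λ _ ()

InAv₂-p123-r132 : ∀ {n} (π : Word n) → InAv₂ p123 r132 π ⇔ (IsPerm π × Avoids₂ π)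
InAv₂-p123-r132 π = mk⇔
  (λ (perm , ¬p , ¬r) → perm , ¬p ∘ from (contains-p123 π) , ¬r ∘ from (contains-r132 π))
  (λ (perm , ¬123 , ¬132) → perm , ¬123 ∘ to (contains-p123 π) , ¬132 ∘ to (contains-r132 π))
  where open Equivalence

-- Appending a last entry

extend : ∀ {n} → Word n → Fin (suc n) → Word (suc n)
extend σ v = map (punchIn v) σ ∷ʳ v

data Position (n : ℕ) : Fin (suc n) → Set where
  old : (i : Fin n) → Position n (inject₁ i)
  new : Position n (fromℕ n)

position : ∀ {n} (i : Fin (suc n)) → Position n i
position {zero}  zero    = new
position {suc n} zero    = old zero
position {suc n} (suc i) with position i
... | old j = old (suc j)
... | new   = new

lookup-∷ʳ-inject₁ : ∀ {A : Set} {n} (xs : Vec A n) x i → lookup (xs ∷ʳ x) (inject₁ i) ≡ lookup xs i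
lookup-∷ʳ-inject₁ (y ∷ xs) x zero    = refl
lookup-∷ʳ-inject₁ (y ∷ xs) x (suc i) = lookup-∷ʳ-inject₁ xs x i

lookup-∷ʳ-fromℕ : ∀ {A : Set} {n} (xs : Vec A n) x → lookup (xs ∷ʳ x) (fromℕ n) ≡ x
lookup-∷ʳ-fromℕ []       x = refl
lookup-∷ʳ-fromℕ (y ∷ xs) x = lookup-∷ʳ-fromℕ xs x

lookup-extend-old : ∀ {n} (σ : Word n) v i → lookup (extend σ v) (inject₁ i) ≡ punchIn v (lookup σ i)
lookup-extend-old σ v i = trans (lookup-∷ʳ-inject₁ (map (punchIn v) σ) v i) (lookup-map i (punchIn v) σ)

lookup-extend-new : ∀ {n} (σ : Word n) v → lookup (extend σ v) (fromℕ n) ≡ v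
lookup-extend-new σ v = lookup-∷ʳ-fromℕ (map (punchIn v) σ) v

entry-extend-old : ∀ {n} (σ : Word n) v i → entry (extend σ v) (inject₁ i) ≡ toℕ (punchIn v (lookup σ i))
entry-extend-old σ v i = cong toℕ (lookup-extend-old σ v i)

entry-extend-new : ∀ {n} (σ : Word n) v → entry (extend σ v) (fromℕ n) ≡ toℕ v
entry-extend-new σ v = cong toℕ (lookup-extend-new σ v)

toℕ-punchIn-< : ∀ {n} (v : Fin (suc n)) (x : Fin n) → toℕ x < toℕ v → toℕ (punchIn v x) ≡ toℕ x
toℕ-punchIn-< (suc v) zero    _         = refl
toℕ-punchIn-< (suc v) (suc x) (s<s x<v) = cong suc (toℕ-punchIn-< v x x<v)

toℕ-punchIn-≥ : ∀ {n} (v : Fin (suc n)) (x : Fin n) → toℕ v ≤ toℕ x → toℕ (punchIn v x) ≡ suc (toℕ x)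
toℕ-punchIn-≥ zero    x       _         = refl
toℕ-punchIn-≥ (suc v) (suc x) (s≤s v≤x) = cong suc (toℕ-punchIn-≥ v x v≤x)

data PunchInCase {n} (v : Fin (suc n)) (x : Fin n) : Set where
  below : toℕ x < toℕ v → toℕ (punchIn v x) ≡ toℕ x → PunchInCase v x
  above : toℕ v ≤ toℕ x → toℕ (punchIn v x) ≡ suc (toℕ x) → PunchInCase v x

punchIn-case : ∀ {n} (v : Fin (suc n)) (x : Fin n) → PunchInCase v x
punchIn-case v x with toℕ x <? toℕ v
... | yes x<v = below x<v (toℕ-punchIn-< v x x<v)
... | no x≮v  = above (≮⇒≥ x≮v) (toℕ-punchIn-≥ v x (≮⇒≥ x≮v))

punchIn-< : ∀ {n} (v : Fin (suc n)) {x y : Fin n} → toℕ x < toℕ y → toℕ (punchIn v x) < toℕ (punchIn v y)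
punchIn-< v {x} {y} x<y = ≤∧≢⇒< (punchIn-mono-≤ v x y (<⇒≤ x<y))
  (λ eq → <-irrefl (cong toℕ (punchIn-injective v x y (toℕ-injective eq))) x<y)

punchIn-<⁻¹ : ∀ {n} (v : Fin (suc n)) {x y : Fin n} → toℕ (punchIn v x) < toℕ (punchIn v y) → toℕ x < toℕ y
punchIn-<⁻¹ v {x} {y} p = ≰⇒> (λ y≤x → <⇒≱ p (punchIn-mono-≤ v y x y≤x))

punchIn-suc : ∀ {n} (v : Fin (suc n)) {x y : Fin n} → toℕ y ≡ suc (toℕ x) → suc (toℕ x) ≢ toℕ v →
              toℕ (punchIn v y) ≡ suc (toℕ (punchIn v x))
punchIn-suc v {x} {y} y≡1+x 1+x≢v with punchIn-case v x | punchIn-case v y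
... | below _ px | below _ py = trans py (trans y≡1+x (cong suc (sym px)))
... | below x<v _ | above v≤y _ = ⊥-elim (1+x≢v (≤-antisym x<v (subst (toℕ v ≤_) y≡1+x v≤y)))
... | above v≤x _ | below y<v _ = ⊥-elim (<-asym (<-≤-trans y<v v≤x) (subst (toℕ x <_) (sym y≡1+x) (n<1+n _)))
... | above _ px | above _ py = trans py (trans (cong suc y≡1+x) (cong suc (sym px)))

punchIn-≥ : ∀ {n} (v : Fin (suc n)) (x : Fin n) → toℕ x ≤ toℕ (punchIn v x)
punchIn-≥ v x with punchIn-case v x
... | below _ px = ≤-reflexive (sym px)
... | above _ px = subst (toℕ x ≤_) (sym px) (n≤1+n _)

punchIn-suc⁻¹ : ∀ {n} (v : Fin (suc n)) {x y : Fin n} →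
                toℕ (punchIn v y) ≡ suc (toℕ (punchIn v x)) → toℕ y ≡ suc (toℕ x)
punchIn-suc⁻¹ v {x} {y} eq with punchIn-case v x | punchIn-case v y
... | below _ px | below _ py = trans (sym py) (trans eq (cong suc px))
... | below x<v px | above v≤y py =
  ⊥-elim (<-irrefl (sym (suc-injective (trans (sym py) (trans eq (cong suc px))))) (<-≤-trans x<v v≤y))
... | above v≤x px | below y<v py =
  ⊥-elim (<-asym (<-≤-trans y<v v≤x) (subst (toℕ x <_) (trans (sym eq) py) (s≤s (punchIn-≥ v x))))
... | above _ px | above _ py = suc-injective (trans (sym py) (trans eq (cong suc px)))

punchIn-<-pivot : ∀ {n} (v : Fin (suc n)) {x : Fin n} → toℕ x < toℕ v → toℕ (punchIn v x) < toℕ v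
punchIn-<-pivot v {x} x<v = subst (_< toℕ v) (sym (toℕ-punchIn-< v x x<v)) x<v

punchIn-<-pivot⁻¹ : ∀ {n} (v : Fin (suc n)) {x : Fin n} → toℕ (punchIn v x) < toℕ v → toℕ x < toℕ v
punchIn-<-pivot⁻¹ v {x} p with punchIn-case v x
... | below x<v _  = x<v
... | above v≤x px = ⊥-elim (<⇒≱ p (subst (toℕ v ≤_) (sym px) (m≤n⇒m≤1+n v≤x)))

punchIn-pivot : ∀ {n} (v : Fin (suc n)) {x : Fin n} → toℕ x ≡ toℕ v → toℕ (punchIn v x) ≡ suc (toℕ v)
punchIn-pivot v {x} x≡v = trans (toℕ-punchIn-≥ v x (≤-reflexive (sym x≡v))) (cong suc x≡v)

punchIn-pivot⁻¹ : ∀ {n} (v : Fin (suc n)) {x : Fin n} → toℕ (punchIn v x) ≡ suc (toℕ v) → toℕ x ≡ toℕ v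
punchIn-pivot⁻¹ v {x} eq with punchIn-case v x
... | below x<v px = ⊥-elim (<-asym x<v (subst (toℕ v <_) (trans (sym eq) px) (n<1+n _)))
... | above _   px = suc-injective (trans (sym px) eq)

inject₁-< : ∀ {n} {i j : Fin n} → toℕ i < toℕ j → toℕ (inject₁ i) < toℕ (inject₁ j)
inject₁-< {i = i} {j} = subst₂ _<_ (sym (toℕ-inject₁ i)) (sym (toℕ-inject₁ j))

inject₁-<⁻¹ : ∀ {n} {i j : Fin n} → toℕ (inject₁ i) < toℕ (inject₁ j) → toℕ i < toℕ j
inject₁-<⁻¹ {i = i} {j} = subst₂ _<_ (toℕ-inject₁ i) (toℕ-inject₁ j)

inject₁-<-fromℕ : ∀ {n} (i : Fin n) → toℕ (inject₁ i) < toℕ (fromℕ n)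
inject₁-<-fromℕ {n} i = subst₂ _<_ (sym (toℕ-inject₁ i)) (sym (toℕ-fromℕ n)) (toℕ<n i)

fromℕ-≮ : ∀ {n} (j : Fin (suc n)) → ¬ toℕ (fromℕ n) < toℕ j
fromℕ-≮ {n} j n<j = <⇒≱ (subst (_< toℕ j) (toℕ-fromℕ n) n<j) (s≤s⁻¹ (toℕ<n j))

module _ {n} (σ : Word n) (v : Fin (suc n)) where

  private
    π : Word (suc n)
    π = extend σ v

  extend-<-old : ∀ {i j} → entry σ i < entry σ j → entry π (inject₁ i) < entry π (inject₁ j)
  extend-<-old {i} {j} = subst₂ _<_ (sym (entry-extend-old σ v i)) (sym (entry-extend-old σ v j)) ∘ punchIn-< v

  extend-<-old⁻¹ : ∀ {i j} → entry π (inject₁ i) < entry π (inject₁ j) → entry σ i < entry σ j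
  extend-<-old⁻¹ {i} {j} = punchIn-<⁻¹ v ∘ subst₂ _<_ (entry-extend-old σ v i) (entry-extend-old σ v j)

  extend-<-new : ∀ {i} → entry σ i < toℕ v → entry π (inject₁ i) < entry π (fromℕ n)
  extend-<-new {i} = subst₂ _<_ (sym (entry-extend-old σ v i)) (sym (entry-extend-new σ v)) ∘ punchIn-<-pivot v

  extend-<-new⁻¹ : ∀ {i} → entry π (inject₁ i) < entry π (fromℕ n) → entry σ i < toℕ v
  extend-<-new⁻¹ {i} = punchIn-<-pivot⁻¹ v ∘ subst₂ _<_ (entry-extend-old σ v i) (entry-extend-new σ v)

  extend-suc-new : ∀ {j} → entry σ j ≡ toℕ v → entry π (inject₁ j) ≡ suc (entry π (fromℕ n))
  extend-suc-new {j} eq =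
    trans (entry-extend-old σ v j) (trans (punchIn-pivot v eq) (cong suc (sym (entry-extend-new σ v))))

  extend-suc-new⁻¹ : ∀ {j} → entry π (inject₁ j) ≡ suc (entry π (fromℕ n)) → entry σ j ≡ toℕ v
  extend-suc-new⁻¹ {j} eq =
    punchIn-pivot⁻¹ v (trans (sym (entry-extend-old σ v j)) (trans eq (cong suc (entry-extend-new σ v))))

  extend-suc-old : ∀ {j k} → entry σ j ≡ suc (entry σ k) → suc (entry σ k) ≢ toℕ v →
                   entry π (inject₁ j) ≡ suc (entry π (inject₁ k))
  extend-suc-old {j} {k} eq ne =
    trans (entry-extend-old σ v j) (trans (punchIn-suc v eq ne) (cong suc (sym (entry-extend-old σ v k))))

  extend-suc-old⁻¹ : ∀ {j k} → entry π (inject₁ j) ≡ suc (entry π (inject₁ k)) →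
                     entry σ j ≡ suc (entry σ k)
  extend-suc-old⁻¹ {j} {k} eq =
    punchIn-suc⁻¹ v (trans (sym (entry-extend-old σ v j)) (trans eq (cong suc (entry-extend-old σ v k))))

  Has123-extend : Has123 σ → Has123 π
  Has123-extend (i , j , k , i<j , j<k , a , b) =
    inject₁ i , inject₁ j , inject₁ k , inject₁-< i<j , inject₁-< j<k , extend-<-old a , extend-<-old b

  NonLRMin<⇒Has123-extend : ∀ {w} → NonLRMin σ w → w < toℕ v → Has123 π
  NonLRMin<⇒Has123-extend (i , j , i<j , a , refl) w<v =
    inject₁ i , inject₁ j , fromℕ n , inject₁-< i<j , inject₁-<-fromℕ j , extend-<-old a , extend-<-new w<v

  NonLRMin≡⇒HasAdjacent132-extend : NonLRMin σ (toℕ v) → HasAdjacent132 π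
  NonLRMin≡⇒HasAdjacent132-extend (i , j , i<j , a , eq) =
    inject₁ i , inject₁ j , fromℕ n , inject₁-< i<j , inject₁-<-fromℕ j ,
    extend-<-new (subst (entry σ i <_) eq a) , extend-suc-new eq

  HasAdjacent132-extend : HasAdjacent132 σ → HasAdjacent132 π
  HasAdjacent132-extend (i , j , k , i<j , j<k , a , eq) with suc (entry σ k) ≟ toℕ v
  ... | yes k+1≡v =
    NonLRMin≡⇒HasAdjacent132-extend (i , j , i<j , <-trans a (subst (entry σ k <_) (sym eq) (n<1+n _)) , trans eq k+1≡v)
  ... | no  k+1≢v =
    inject₁ i , inject₁ j , inject₁ k , inject₁-< i<j , inject₁-< j<k , extend-<-old a , extend-suc-old eq k+1≢v

  Has123-extend⁻¹ : Has123 π → Has123 σ ⊎ Σ[ w ∈ ℕ ] NonLRMin σ w × w < toℕ v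
  Has123-extend⁻¹ (i , j , k , i<j , j<k , a , b) with position i | position j | position k
  ... | old i | old j | old k =
    inj₁ (i , j , k , inject₁-<⁻¹ i<j , inject₁-<⁻¹ j<k , extend-<-old⁻¹ a , extend-<-old⁻¹ b)
  ... | old i | old j | new =
    inj₂ (entry σ j , (i , j , inject₁-<⁻¹ i<j , extend-<-old⁻¹ a , refl) , extend-<-new⁻¹ b)
  ... | old _ | new   | _   = ⊥-elim (fromℕ-≮ k j<k)
  ... | new   | _     | _   = ⊥-elim (fromℕ-≮ j i<j)

  HasAdjacent132-extend⁻¹ : HasAdjacent132 π → HasAdjacent132 σ ⊎ NonLRMin σ (toℕ v)
  HasAdjacent132-extend⁻¹ (i , j , k , i<j , j<k , a , eq) with position i | position j | position k
  ... | old i | old j | old k =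
    inj₁ (i , j , k , inject₁-<⁻¹ i<j , inject₁-<⁻¹ j<k , extend-<-old⁻¹ a , extend-suc-old⁻¹ eq)
  ... | old i | old j | new =
    let j≡v = extend-suc-new⁻¹ eq in
    inj₂ (i , j , inject₁-<⁻¹ i<j , subst (entry σ i <_) (sym j≡v) (extend-<-new⁻¹ a) , j≡v)
  ... | old _ | new   | _   = ⊥-elim (fromℕ-≮ k j<k)
  ... | new   | _     | _   = ⊥-elim (fromℕ-≮ j i<j)

  extend-avoids : Avoids₂ σ → (∀ w → NonLRMin σ w → toℕ v < w) → Avoids₂ π
  extend-avoids (¬123 , ¬132) v<NonLRMin = ¬123′ ∘ Has123-extend⁻¹ , ¬132′ ∘ HasAdjacent132-extend⁻¹
    where
    ¬123′ : ¬ (Has123 σ ⊎ Σ[ w ∈ ℕ ] NonLRMin σ w × w < toℕ v)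
    ¬123′ (inj₁ c)             = ¬123 c
    ¬123′ (inj₂ (w , m , w<v)) = <-asym w<v (v<NonLRMin w m)
    ¬132′ : ¬ (HasAdjacent132 σ ⊎ NonLRMin σ (toℕ v))
    ¬132′ (inj₁ c) = ¬132 c
    ¬132′ (inj₂ m) = <-irrefl refl (v<NonLRMin _ m)

  extend-avoids⁻¹ : Avoids₂ π → Avoids₂ σ × (∀ w → NonLRMin σ w → toℕ v < w)
  extend-avoids⁻¹ (¬123 , ¬132) = (¬123 ∘ Has123-extend , ¬132 ∘ HasAdjacent132-extend) , v<NonLRMin
    where
    v<NonLRMin : ∀ w → NonLRMin σ w → toℕ v < w
    v<NonLRMin w m with <-cmp w (toℕ v)
    ... | tri< w<v _ _ = ⊥-elim (¬123 (NonLRMin<⇒Has123-extend m w<v))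
    ... | tri≈ _ refl _ = ⊥-elim (¬132 (NonLRMin≡⇒HasAdjacent132-extend m))
    ... | tri> _ _ v<w = v<w

  NonLRMin-extend⁻¹ : ∀ {w} → NonLRMin π w →
    (Σ[ j ∈ Fin n ] NonLRMin σ (entry σ j) × w ≡ toℕ (punchIn v (lookup σ j))) ⊎
    (w ≡ toℕ v × Σ[ i ∈ Fin n ] entry σ i < toℕ v)
  NonLRMin-extend⁻¹ (i , j , i<j , a , refl) with position i | position j
  ... | old i | old j = inj₁ (j , (i , j , inject₁-<⁻¹ i<j , extend-<-old⁻¹ a , refl) , entry-extend-old σ v j)
  ... | old i | new   = inj₂ (entry-extend-new σ v , i , extend-<-new⁻¹ a)
  ... | new   | _     = ⊥-elim (fromℕ-≮ j i<j)

  NonLRMin-extend-new : ∀ {i} → entry σ i < toℕ v → NonLRMin π (toℕ v)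
  NonLRMin-extend-new {i} a = inject₁ i , fromℕ n , inject₁-<-fromℕ i , extend-<-new a , entry-extend-new σ v

NonLRMin-extend-zero : ∀ {n} (σ : Word n) {w} → NonLRMin σ w → NonLRMin (extend σ zero) (suc w)
NonLRMin-extend-zero σ (i , j , i<j , a , refl) =
  inject₁ i , inject₁ j , inject₁-< i<j , extend-<-old σ zero a , entry-extend-old σ zero j

extend-perm : ∀ {n} (σ : Word n) v → IsPerm σ → IsPerm (extend σ v)
extend-perm σ v σ-perm {x} {y} eq with position x | position y
... | old i | old j = cong inject₁ (σ-perm (punchIn-injective v _ _
                        (trans (sym (lookup-extend-old σ v i)) (trans eq (lookup-extend-old σ v j)))))
... | old i | new   =
  ⊥-elim (punchInᵢ≢i v _ (trans (sym (lookup-extend-old σ v i)) (trans eq (lookup-extend-new σ v))))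
... | new   | old j =
  ⊥-elim (punchInᵢ≢i v _ (trans (sym (lookup-extend-old σ v j)) (trans (sym eq) (lookup-extend-new σ v))))
... | new   | new   = refl

map-injective : ∀ {A B : Set} {f : A → B} {n} → Injective _≡_ _≡_ f → Injective _≡_ _≡_ (map {n = n} f)
map-injective f-inj {[]}     {[]}     _  = refl
map-injective f-inj {x ∷ xs} {y ∷ ys} eq =
  cong₂ _∷_ (f-inj (proj₁ (∷-injective eq))) (map-injective f-inj (proj₂ (∷-injective eq)))

extend-injective : ∀ {n} {σ σ′ : Word n} {v v′} → extend σ v ≡ extend σ′ v′ → σ ≡ σ′ × v ≡ v′
extend-injective {σ = σ} {σ′} {v} {v′} eq with ∷ʳ-injective (map (punchIn v) σ) (map (punchIn v′) σ′) eq
... | eq′ , refl = map-injective (punchIn-injective v _ _) eq′ , refl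

perm-surjective : ∀ {n} {σ : Word n} → IsPerm σ → ∀ x → ∃ λ i → lookup σ i ≡ x
perm-surjective {suc n} {σ} σ-perm x with any? (λ i → lookup σ i ≟ᶠ x)
... | yes hit = hit
... | no miss = ⊥-elim (<⇒notInjective ≤-refl punchOut-inj)
  where
  skip : ∀ i → x ≢ lookup σ i
  skip i eq = miss (i , sym eq)
  punchOut-inj : Injective _≡_ _≡_ (λ i → punchOut (skip i))
  punchOut-inj eq = σ-perm (punchOut-injective (skip _) (skip _) eq)

lookup-ext : ∀ {A : Set} {n} (xs ys : Vec A n) → (∀ i → lookup xs i ≡ lookup ys i) → xs ≡ ys
lookup-ext xs ys eq = trans (sym (tabulate∘lookup xs)) (trans (tabulate-cong eq) (tabulate∘lookup ys))

unextend : ∀ {n} (π : Word (suc n)) → IsPerm π →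
           Σ[ σ ∈ Word n ] Σ[ v ∈ Fin (suc n) ] IsPerm σ × extend σ v ≡ π
unextend {n} π π-perm = σ , v , σ-perm , lookup-ext (extend σ v) π same
  where
  v : Fin (suc n)
  v = lookup π (fromℕ n)
  v≢ : ∀ i → v ≢ lookup π (inject₁ i)
  v≢ i eq = fromℕ≢inject₁ (π-perm eq)
  σ : Word n
  σ = tabulate (λ i → punchOut (v≢ i))
  σ-perm : IsPerm σ
  σ-perm {i} {j} eq = inject₁-injective (π-perm (punchOut-injective (v≢ i) (v≢ j)
                        (trans (sym (lookup∘tabulate _ i)) (trans eq (lookup∘tabulate _ j)))))
  same : ∀ k → lookup (extend σ v) k ≡ lookup π k
  same k with position k
  ... | old i =
    trans (lookup-extend-old σ v i) (trans (cong (punchIn v) (lookup∘tabulate _ i)) (punchIn-punchOut (v≢ i)))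
  ... | new   = lookup-extend-new σ v

-- Decoding paths into permutations

-- e + 1 is the least value of an entry that is not a left-to-right minimum, and e = n if there
-- is no such entry; by extend-avoids, σ extends to an avoider by exactly the values v ≤ e.
Threshold : ∀ {n} → Word n → ℕ → Set
Threshold {n} σ e = (∀ w → NonLRMin σ w → e < w) × (e ≡ n ⊎ NonLRMin σ (suc e))

below-threshold : ∀ {n} (σ : Word n) {e v} → Threshold σ e → v ≤ e → ∀ w → NonLRMin σ w → v < w
below-threshold σ (e<NonLRMin , _) v≤e w m = ≤-<-trans v≤e (e<NonLRMin w m)

below-threshold⁻¹ : ∀ {n} (σ : Word n) {e} (v : Fin (suc n)) → Threshold σ e →
                    (∀ w → NonLRMin σ w → toℕ v < w) → toℕ v ≤ e
below-threshold⁻¹ σ v (_ , inj₁ refl) _          = s≤s⁻¹ (toℕ<n v)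
below-threshold⁻¹ σ v (_ , inj₂ m)    v<NonLRMin = s≤s⁻¹ (v<NonLRMin _ m)

threshold-extend-zero : ∀ {n} (σ : Word n) {e} → Threshold σ e → Threshold (extend σ zero) (suc e)
threshold-extend-zero {n} σ {e} (e<NonLRMin , top) = bound , witness top
  where
  bound : ∀ w → NonLRMin (extend σ zero) w → suc e < w
  bound w m with NonLRMin-extend⁻¹ σ zero m
  ... | inj₁ (j , mj , refl) = s≤s (e<NonLRMin _ mj)
  ... | inj₂ (_ , _ , ())
  witness : e ≡ n ⊎ NonLRMin σ (suc e) → suc e ≡ suc n ⊎ NonLRMin (extend σ zero) (suc (suc e))
  witness (inj₁ refl) = inj₁ refl
  witness (inj₂ m)    = inj₂ (NonLRMin-extend-zero σ m)

threshold-extend-suc : ∀ {n} (σ : Word n) {e j} (v : Fin (suc n)) → IsPerm σ → Threshold σ e →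
                       toℕ v ≡ suc j → j < e → Threshold (extend σ v) j
threshold-extend-suc {suc n} σ {e} {j} v σ-perm (e<NonLRMin , _) v≡1+j j<e =
  bound , inj₂ (subst (NonLRMin (extend σ v)) v≡1+j v-NonLRMin)
  where
  bound : ∀ w → NonLRMin (extend σ v) w → j < w
  bound w m with NonLRMin-extend⁻¹ σ v m
  ... | inj₁ (k , mk , refl) = <-≤-trans (<-trans j<e (e<NonLRMin _ mk)) (punchIn-≥ v _)
  ... | inj₂ (refl , _)      = subst (j <_) (sym v≡1+j) (n<1+n j)
  v-NonLRMin : NonLRMin (extend σ v) (toℕ v)
  v-NonLRMin with perm-surjective {σ = σ} σ-perm zero
  ... | i , σi≡0 =
    NonLRMin-extend-new σ v {i} (subst (_< toℕ v) (sym (cong toℕ σi≡0)) (subst (0 <_) (sym v≡1+j) z<s))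
threshold-extend-suc {zero} _ zero _ _ () _

end≤length : ∀ {n e} → Path 0 n e → e ≤ n
end≤length ε       = z≤n
end≤length (p ↑)   = s≤s (end≤length p)
end≤length (p ↓ j) = m≤n⇒m≤1+n (<⇒≤ (<-≤-trans (toℕ<n j) (end≤length p)))

down-value : ∀ {n e} → Path 0 n e → Fin e → Fin (suc n)
down-value p j = suc (inject≤ j (end≤length p))

toℕ-down-value : ∀ {n e} (p : Path 0 n e) (j : Fin e) → toℕ (down-value p j) ≡ suc (toℕ j)
toℕ-down-value p j = cong suc (toℕ-inject≤ j (end≤length p))

decode : ∀ {n e} → Path 0 n e → Word n
decode ε       = []
decode (p ↑)   = extend (decode p) zero
decode (p ↓ j) = extend (decode p) (down-value p j)

decode-valid : ∀ {n e} (p : Path 0 n e) → IsPerm (decode p) × Avoids₂ (decode p) × Threshold (decode p) e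
decode-valid ε = (λ { {()} }) , ((λ ()) , (λ ())) , (λ { _ (() , _) }) , inj₁ refl
decode-valid (p ↑) with decode-valid p
... | perm , avoids , threshold =
  extend-perm (decode p) zero perm , extend-avoids (decode p) zero avoids (below-threshold (decode p) threshold z≤n) ,
  threshold-extend-zero (decode p) threshold
decode-valid (_↓_ {e = e} p j) with decode-valid p
... | perm , avoids , threshold =
  extend-perm (decode p) v perm ,
  extend-avoids (decode p) v avoids (below-threshold (decode p) threshold v≤e) ,
  threshold-extend-suc (decode p) v perm threshold (toℕ-down-value p j) (toℕ<n j)
  where
  v : Fin (suc _)
  v = down-value p j
  v≤e : toℕ v ≤ e
  v≤e = subst (_≤ e) (sym (toℕ-down-value p j)) (toℕ<n j)

decode-injective : ∀ {n e e′} (p : Path 0 n e) (p′ : Path 0 n e′) →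
                   decode p ≡ decode p′ → _≡_ {A = Paths n} (e , p) (e′ , p′)
decode-injective ε ε _ = refl
decode-injective (p ↑) (p′ ↑) eq with decode-injective p p′ (proj₁ (extend-injective eq))
... | refl = refl
decode-injective (p ↑) (p′ ↓ j′) eq with () ← proj₂ (extend-injective eq)
decode-injective (p ↓ j) (p′ ↑) eq with () ← proj₂ (extend-injective eq)
decode-injective (p ↓ j) (p′ ↓ j′) eq with decode-injective p p′ (proj₁ (extend-injective eq))
... | refl with inject≤-injective _ _ j j′ (Fin-suc-injective (proj₂ (extend-injective eq)))
...   | refl = refl

decode-surjective : ∀ {n} (π : Word n) → IsPerm π → Avoids₂ π → Σ[ (e , p) ∈ Paths n ] decode p ≡ π
decode-surjective [] _ _ = (0 , ε) , refl
decode-surjective {suc n} π π-perm π-avoids with unextend π π-perm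
... | σ , v , σ-perm , refl with extend-avoids⁻¹ σ v π-avoids
...   | σ-avoids , v<NonLRMin with decode-surjective σ σ-perm σ-avoids
...     | (e , p) , refl = step v (below-threshold⁻¹ (decode p) v (proj₂ (proj₂ (decode-valid p))) v<NonLRMin)
  where
  step : ∀ v → toℕ v ≤ e → Σ[ (_ , p′) ∈ Paths (suc n) ] decode p′ ≡ extend (decode p) v
  step zero    _   = (suc e , p ↑) , refl
  step (suc w) w<e =
    (toℕ j , p ↓ j) , cong (extend (decode p) ∘ suc) (toℕ-injective (trans (toℕ-inject≤ j _) (toℕ-fromℕ< w<e)))
    where
    j : Fin e
    j = fromℕ< w<e

hasCard-↔ : ∀ {n m} {P : Word n → Set} {A : Set} → Fin m ↔ A → (f : A → Word n) → Injective _≡_ _≡_ f →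
            (∀ a → P (f a)) → (∀ π → P π → ∃ λ a → f a ≡ π) → HasCard P m
hasCard-↔ {P = P} m↔A f f-injective valid surjective = f ∘ to , to-injective ∘ f-injective , valid ∘ to , covers
  where
  open Inverse m↔A
  to-injective : Injective _≡_ _≡_ to
  to-injective {x} {y} eq = trans (sym (strictlyInverseʳ x)) (trans (cong from eq) (strictlyInverseʳ y))
  covers : ∀ π → P π → ∃ λ k → f (to k) ≡ π
  covers π Pπ with surjective π Pπ
  ... | a , fa≡π = from a , trans (cong f (strictlyInverseˡ a)) fa≡π

proposition18 : (n : ℕ) → HasCard {n} (InAv₂ p123 r132) (motzkin n)
proposition18 n = hasCard-↔ (motzkin↔Paths n) (λ (_ , p) → decode p)
  (λ {(_ , p)} {(_ , p′)} → decode-injective p p′)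
  (λ (_ , p) → let perm , avoids , _ = decode-valid p in Equivalence.from (InAv₂-p123-r132 (decode p)) (perm , avoids))
  (λ π inAv → let perm , avoids = Equivalence.to (InAv₂-p123-r132 π) inAv in decode-surjective π perm avoids)
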